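{- Let $k\ge 2$ and $G=\Theta(2,2,2k)$ with end vertices $u$ and $v$. If $m\ge 4$ and $L$ is an $m$-assignment for $G$ with $L(u)\ne L(v)$, then $P(G,L)\ge P(G,m)$.
   Context: $\Theta(l_1,l_2,l_3)$ is the graph of two end vertices joined by three internally disjoint paths of lengths $l_1,l_2,l_3$. An $m$-assignment $L$ gives each vertex a set of $m$ colors; $P(G,L)$ is the number of proper colorings $f$ of $G$ with $f(w)\in L(w)$ for all $w$; $P(G,m)$ is the chromatic polynomial. -}

module Defs where

open import Data.Nat using (ℕ; zero; suc; _+_; _∸_; _≡ᵇ_; _<_)
open import Data.Bool using (Bool; true; false; not; if_then_else_)
open import Data.List using (List; []; _∷_; _++_; map; concatMap; length)
open import Data.List.Membership.Propositional using (_∈_)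
open import Data.List.Relation.Unary.Unique.Propositional using (Unique)
open import Data.Product using (_×_; _,_)
open import Relation.Binary.PropositionalEquality using (_≡_)

-- A finite graph: vertices are 0 , 1 , ... , nV - 1 ; edges as an edge list.
record Graph : Set where
  field
    nV    : ℕ
    edges : List (ℕ × ℕ)
open Graph public

-- Edges of a path of length l from a to b whose l - 1 internal vertices are
-- s , s+1 , ... , s + l - 2 (in order along the path).
pathEdges : ℕ → ℕ → ℕ → ℕ → List (ℕ × ℕ)
pathEdges a b s zero = []
pathEdges a b s (suc zero) = (a , b) ∷ []
pathEdges a b s (suc (suc l)) = (a , s) ∷ pathEdges s b (suc s) (suc l)

-- Theta(l1,l2,l3): end vertices u = 0 and v = 1 joined by three internally
-- disjoint paths of lengths l1, l2, l3 (all lengths assumed ≥ 1).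
Theta : ℕ → ℕ → ℕ → Graph
Theta l₁ l₂ l₃ = record
  { nV = 2 + (l₁ ∸ 1) + (l₂ ∸ 1) + (l₃ ∸ 1)
  ; edges = pathEdges 0 1 2 l₁
         ++ pathEdges 0 1 (2 + (l₁ ∸ 1)) l₂
         ++ pathEdges 0 1 (2 + (l₁ ∸ 1) + (l₂ ∸ 1)) l₃
  }

ListAssignment : Set
ListAssignment = ℕ → List ℕ

IsMAssignment : Graph → ℕ → ListAssignment → Set
IsMAssignment G m L = ∀ w → w < nV G → Unique (L w) × length (L w) ≡ m

SameSet : List ℕ → List ℕ → Set
SameSet xs ys = ∀ c → (c ∈ xs → c ∈ ys) × (c ∈ ys → c ∈ xs)

-- All colourings f of the vertices i , i+1 , ... , i+n-1 with f(w) ∈ L(w),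
-- represented as the list [f(i), ..., f(i+n-1)].
choicesFrom : ListAssignment → ℕ → ℕ → List (List ℕ)
choicesFrom L i zero = [] ∷ []
choicesFrom L i (suc n) =
  concatMap (λ c → map (c ∷_) (choicesFrom L (suc i) n)) (L i)

nth : List ℕ → ℕ → ℕ
nth [] _ = 0
nth (x ∷ xs) zero = x
nth (x ∷ xs) (suc n) = nth xs n

allB : {A : Set} → (A → Bool) → List A → Bool
allB p [] = true
allB p (x ∷ xs) = if p x then allB p xs else false

isProper : Graph → List ℕ → Bool
isProper G f = allB (λ { (a , b) → not (nth f a ≡ᵇ nth f b) }) (edges G)

countTrue : {A : Set} → (A → Bool) → List A → ℕ
countTrue p [] = 0
countTrue p (x ∷ xs) = if p x then suc (countTrue p xs) else countTrue p xs

PL : Graph → ListAssignment → ℕ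
PL G L = countTrue (isProper G) (choicesFrom L 0 (nV G))

Pm : Graph → ℕ → ℕ
Pm G m = PL G (λ _ → Data.List.upTo m)

module Submission where

open import Defs
open import Data.Nat using (ℕ; _≤_; _*_)
open import Relation.Nullary using (¬_)
open import Data.Bool using (Bool; true; false; not; if_then_else_; T)
open import Data.List using (List; []; _∷_; _++_; map; concatMap; length; replicate)
open import Data.List.Membership.Propositional using (_∈_; _∉_)
open import Data.List.Properties using (++-assoc; ++-identityʳ; length-++; length-upTo)
open import Data.List.Relation.Unary.All using (All; []; _∷_)
open import Data.List.Relation.Unary.All.Properties using (¬Any⇒All¬)
open import Data.List.Relation.Unary.AllPairs using ([]; _∷_)
open import Data.List.Relation.Unary.Any using (here; there)
open import Data.List.Relation.Unary.Unique.Propositional using (Unique)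
open import Data.List.Relation.Unary.Unique.Propositional.Properties using (upTo⁺)
open import Data.Nat using (zero; suc; _+_; _∸_; _^_; _≡ᵇ_; _<_; z≤n; s≤s; z<s)
open import Data.Nat.Properties
open import Data.List.Membership.DecPropositional _≟_ using (_∈?_)
open import Data.Nat.Tactic.RingSolver using (solve-∀)
open import Data.Product using (_×_; _,_; proj₁; proj₂)
open import Function using (_∘_)
open import Relation.Binary.PropositionalEquality
open import Relation.Nullary using (yes; no; contradiction)

-- Colouring u = 0, v = 1 and the middle vertices 2, 3 of the two short paths first gives
-- P(G, L) = Σ_{a ∈ L(u)} Σ_{b ∈ L(v)} X₂(a, b) X₃(a, b) N(a, b), where X_i(a, b) counts the colours
-- of L(i) other than a and b, and N(a, b) counts the colourings of the 2k − 1 inner vertices of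
-- the long path between the end colours a and b.  Let q = m − 2 and F = F_{2k−1}, where F₁ = q and
-- F_{r+2} = (q + 1)² F_r + q.
-- * Taking the long path two vertices at a time shows N(a, b) ≥ F for every m-assignment.
-- * For the constant assignment X_i = q + [a = b] and N = F + [a = b], so
--   P(G, m) = m ((q + 1) q² F + (q + 1)² (F + 1)).
-- * For L, X_i ≥ q gives X₂ X₃ ≥ q (X₂ + X₃) − q², and Σ Σ X_i ≥ (q + 1)(m² − (q + 1)) because
--   L(u) ≠ L(v) share at most m − 1 colours; hence Σ Σ X₂ X₃ ≥ m² q² + (2q + 1) m + 2 when q ≥ 2.
-- Finally m (q + 1)² ≤ 2F when k ≥ 2, which is what makes F · Σ Σ X₂ X₃ ≥ P(G, m).

-- Sums over lists

∑ : List ℕ → (ℕ → ℕ) → ℕ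
∑ []       f = 0
∑ (x ∷ xs) f = f x + ∑ xs f

infix 5 ∑
syntax ∑ xs (λ x → e) = ∑[ x ∈ xs ] e

∑-cong∈ : ∀ xs {f g : ℕ → ℕ} → (∀ {x} → x ∈ xs → f x ≡ g x) → ∑ xs f ≡ ∑ xs g
∑-cong∈ []       _  = refl
∑-cong∈ (x ∷ xs) eq = cong₂ _+_ (eq (here refl)) (∑-cong∈ xs (eq ∘ there))

∑-cong : ∀ xs {f g : ℕ → ℕ} → (∀ x → f x ≡ g x) → ∑ xs f ≡ ∑ xs g
∑-cong xs eq = ∑-cong∈ xs (λ {x} _ → eq x)

∑-mono-≤ : ∀ xs {f g : ℕ → ℕ} → (∀ x → f x ≤ g x) → ∑ xs f ≤ ∑ xs g
∑-mono-≤ []       _  = z≤n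
∑-mono-≤ (x ∷ xs) le = +-mono-≤ (le x) (∑-mono-≤ xs le)

∑-distrib-+ : ∀ xs (f g : ℕ → ℕ) → ∑[ x ∈ xs ] (f x + g x) ≡ ∑ xs f + ∑ xs g
∑-distrib-+ []       f g = refl
∑-distrib-+ (x ∷ xs) f g = begin
  f x + g x + (∑[ y ∈ xs ] (f y + g y)) ≡⟨ cong (f x + g x +_) (∑-distrib-+ xs f g) ⟩
  f x + g x + (∑ xs f + ∑ xs g)         ≡⟨ interchange (f x) (g x) (∑ xs f) (∑ xs g) ⟩
  (f x + ∑ xs f) + (g x + ∑ xs g)       ∎
  where
  open ≡-Reasoning
  interchange : ∀ a b c d → a + b + (c + d) ≡ (a + c) + (b + d)
  interchange = solve-∀

∑-*ˡ : ∀ xs c (f : ℕ → ℕ) → ∑[ x ∈ xs ] c * f x ≡ c * ∑ xs f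
∑-*ˡ []       c f = sym (*-zeroʳ c)
∑-*ˡ (x ∷ xs) c f = trans (cong (c * f x +_) (∑-*ˡ xs c f)) (sym (*-distribˡ-+ c (f x) _))

∑-*ʳ : ∀ xs c (f : ℕ → ℕ) → ∑[ x ∈ xs ] f x * c ≡ ∑ xs f * c
∑-*ʳ []       c f = refl
∑-*ʳ (x ∷ xs) c f = trans (cong (f x * c +_) (∑-*ʳ xs c f)) (sym (*-distribʳ-+ c (f x) _))

∑-const : ∀ xs c → ∑[ _ ∈ xs ] c ≡ length xs * c
∑-const []       c = refl
∑-const (x ∷ xs) c = cong (c +_) (∑-const xs c)

∑-length : ∀ xs → ∑[ _ ∈ xs ] 1 ≡ length xs
∑-length xs = trans (∑-const xs 1) (*-identityʳ (length xs))

∑-comm : ∀ xs ys (f : ℕ → ℕ → ℕ) →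
         ∑[ x ∈ xs ] ∑[ y ∈ ys ] f x y ≡ ∑[ y ∈ ys ] ∑[ x ∈ xs ] f x y
∑-comm []       ys f = sym (trans (∑-const ys 0) (*-zeroʳ (length ys)))
∑-comm (x ∷ xs) ys f = trans (cong (∑ ys (f x) +_) (∑-comm xs ys f)) (sym (∑-distrib-+ ys (f x) _))

∑-comm-*ʳ : ∀ xs ys (φ : ℕ → ℕ → ℕ) (g : ℕ → ℕ) →
            ∑[ x ∈ xs ] ∑[ y ∈ ys ] φ x y * g y ≡ ∑[ y ∈ ys ] (∑[ x ∈ xs ] φ x y) * g y
∑-comm-*ʳ xs ys φ g =
  trans (∑-comm xs ys (λ x y → φ x y * g y)) (∑-cong ys (λ y → ∑-*ʳ xs (g y) (λ x → φ x y)))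

∑≤length : ∀ xs (f : ℕ → ℕ) → (∀ x → f x ≤ 1) → ∑ xs f ≤ length xs
∑≤length xs f f≤1 = ≤-trans (∑-mono-≤ xs f≤1) (≤-reflexive (∑-length xs))

∑<length : ∀ xs (f : ℕ → ℕ) {x} → (∀ y → f y ≤ 1) → x ∈ xs → f x ≡ 0 →
           ∑ xs f < length xs
∑<length (y ∷ ys) f f≤1 (here refl) fy≡0 rewrite fy≡0 = s≤s (∑≤length ys f f≤1)
∑<length (y ∷ ys) f f≤1 (there x∈ys) fx≡0 =
  s≤s (≤-trans (+-monoˡ-≤ (∑ ys f) (f≤1 y)) (∑<length ys f f≤1 x∈ys fx≡0))

rearrangement : ∀ {a b x y} → a ≤ x → b ≤ y → a * y + x * b ≤ x * y + a * b
rearrangement {a} {b} a≤x b≤y with m≤n⇒∃[o]m+o≡n a≤x | m≤n⇒∃[o]m+o≡n b≤y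
... | d , refl | e , refl = ≤-trans (m≤m+n _ (d * e)) (≤-reflexive (expand a b d e))
  where
  expand : ∀ a b d e → a * (b + e) + (a + d) * b + d * e ≡ (a + d) * (b + e) + a * b
  expand = solve-∀

∑-rearrangement : ∀ xs {a b} (x y : ℕ → ℕ) → (∀ w → a ≤ x w) → (∀ w → b ≤ y w) →
                  a * ∑ xs y + ∑ xs x * b ≤ (∑[ w ∈ xs ] x w * y w) + length xs * (a * b)
∑-rearrangement xs {a} {b} x y a≤x b≤y = begin
  a * ∑ xs y + ∑ xs x * b
    ≡⟨ cong₂ _+_ (∑-*ˡ xs a y) (∑-*ʳ xs b x) ⟨
  (∑[ w ∈ xs ] a * y w) + (∑[ w ∈ xs ] x w * b)
    ≡⟨ ∑-distrib-+ xs _ _ ⟨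
  ∑[ w ∈ xs ] (a * y w + x w * b)
    ≤⟨ ∑-mono-≤ xs (λ w → rearrangement (a≤x w) (b≤y w)) ⟩
  ∑[ w ∈ xs ] (x w * y w + a * b)
    ≡⟨ ∑-distrib-+ xs _ _ ⟩
  (∑[ w ∈ xs ] x w * y w) + (∑[ _ ∈ xs ] a * b)
    ≡⟨ cong (_ +_) (∑-const xs (a * b)) ⟩
  (∑[ w ∈ xs ] x w * y w) + length xs * (a * b)
    ∎
  where open ≤-Reasoning

-- Indicators and multiplicities

ι : Bool → ℕ
ι true  = 1
ι false = 0

⟦_≡_⟧ ⟦_≠_⟧ : ℕ → ℕ → ℕ
⟦ a ≡ b ⟧ = ι (a ≡ᵇ b)
⟦ a ≠ b ⟧ = ι (not (a ≡ᵇ b))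

ι-not : ∀ β → ι (not β) + ι β ≡ 1
ι-not true  = refl
ι-not false = refl

ι-inclusion-exclusion : ∀ α β → ι (not α) * ι (not β) + (ι α + ι β) ≡ 1 + ι α * ι β
ι-inclusion-exclusion true  true  = refl
ι-inclusion-exclusion true  false = refl
ι-inclusion-exclusion false true  = refl
ι-inclusion-exclusion false false = refl

ι-interpolation : ∀ (φ : Bool → ℕ) β → φ β ≡ ι (not β) * φ false + ι β * φ true
ι-interpolation φ true  = sym (+-identityʳ _)
ι-interpolation φ false = sym (trans (+-identityʳ _) (+-identityʳ _))

≡ᵇ-refl : ∀ a → (a ≡ᵇ a) ≡ true
≡ᵇ-refl zero    = refl
≡ᵇ-refl (suc a) = ≡ᵇ-refl a

≡ᵇ-comm : ∀ a b → (a ≡ᵇ b) ≡ (b ≡ᵇ a)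
≡ᵇ-comm zero    zero    = refl
≡ᵇ-comm zero    (suc b) = refl
≡ᵇ-comm (suc a) zero    = refl
≡ᵇ-comm (suc a) (suc b) = ≡ᵇ-comm a b

≡ᵇ-true⇒≡ : ∀ a b → (a ≡ᵇ b) ≡ true → a ≡ b
≡ᵇ-true⇒≡ a b eq = ≡ᵇ⇒≡ a b (subst T (sym eq) _)

≢⇒≡ᵇ-false : ∀ a b → a ≢ b → (a ≡ᵇ b) ≡ false
≢⇒≡ᵇ-false a b a≢b with a ≡ᵇ b in eq
... | true  = contradiction (≡ᵇ-true⇒≡ a b eq) a≢b
... | false = refl

⟦≡⟧-subst : ∀ a c (h : ℕ → ℕ) → ⟦ a ≡ c ⟧ * h c ≡ ⟦ a ≡ c ⟧ * h a
⟦≡⟧-subst a c h with a ≡ᵇ c in eq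
... | true  = cong (λ x → 1 * h x) (sym (≡ᵇ-true⇒≡ a c eq))
... | false = refl

∑-≡ᵇ-comm : ∀ xs b (φ : Bool → ℕ) → ∑[ x ∈ xs ] φ (b ≡ᵇ x) ≡ ∑[ x ∈ xs ] φ (x ≡ᵇ b)
∑-≡ᵇ-comm xs b φ = ∑-cong xs (λ x → cong φ (≡ᵇ-comm b x))

∑-ι-not : ∀ xs (p : ℕ → Bool) →
          (∑[ x ∈ xs ] ι (not (p x))) + (∑[ x ∈ xs ] ι (p x)) ≡ length xs
∑-ι-not xs p = begin
  (∑[ x ∈ xs ] ι (not (p x))) + (∑[ x ∈ xs ] ι (p x)) ≡⟨ ∑-distrib-+ xs _ _ ⟨
  ∑[ x ∈ xs ] (ι (not (p x)) + ι (p x))               ≡⟨ ∑-cong xs (ι-not ∘ p) ⟩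
  ∑[ _ ∈ xs ] 1                                       ≡⟨ ∑-length xs ⟩
  length xs                                           ∎
  where open ≡-Reasoning

count : ℕ → List ℕ → ℕ
count b xs = ∑[ x ∈ xs ] ⟦ x ≡ b ⟧

count≡0 : ∀ {b} xs → All (b ≢_) xs → count b xs ≡ 0
count≡0     []       []           = refl
count≡0 {b} (x ∷ xs) (b≢x ∷ b≢xs) rewrite ≢⇒≡ᵇ-false x b (b≢x ∘ sym) = count≡0 xs b≢xs

∉⇒count≡0 : ∀ {b xs} → b ∉ xs → count b xs ≡ 0
∉⇒count≡0 {xs = xs} b∉xs = count≡0 xs (¬Any⇒All¬ xs b∉xs)

count≤1 : ∀ b {xs} → Unique xs → count b xs ≤ 1
count≤1 b {[]}     []           = z≤n
count≤1 b {x ∷ xs} (x∉xs ∷ uxs) with x ≡ᵇ b in eq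
... | true  rewrite ≡ᵇ-true⇒≡ x b eq | count≡0 xs x∉xs = ≤-refl
... | false = count≤1 b uxs

count≥1 : ∀ {b xs} → b ∈ xs → 1 ≤ count b xs
count≥1 {b}         (here refl)  rewrite ≡ᵇ-refl b = s≤s z≤n
count≥1 {b} {x ∷ _} (there b∈xs) = ≤-trans (count≥1 b∈xs) (m≤n+m _ ⟦ x ≡ b ⟧)

count≡1 : ∀ {b xs} → Unique xs → b ∈ xs → count b xs ≡ 1
count≡1 {b} uxs b∈xs = ≤-antisym (count≤1 b uxs) (count≥1 b∈xs)

∑-⟦≡⟧-* : ∀ xs a (h : ℕ → ℕ) → ∑[ w ∈ xs ] ⟦ a ≡ w ⟧ * h w ≡ count a xs * h a
∑-⟦≡⟧-* xs a h = begin
  ∑[ w ∈ xs ] ⟦ a ≡ w ⟧ * h w   ≡⟨ ∑-cong xs (λ w → ⟦≡⟧-subst a w h) ⟩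
  ∑[ w ∈ xs ] ⟦ a ≡ w ⟧ * h a   ≡⟨ ∑-*ʳ xs (h a) _ ⟩
  (∑[ w ∈ xs ] ⟦ a ≡ w ⟧) * h a ≡⟨ cong (_* h a) (∑-≡ᵇ-comm xs a ι) ⟩
  count a xs * h a              ∎
  where open ≡-Reasoning

∑-select : ∀ {a xs} (h : ℕ → ℕ) → Unique xs → a ∈ xs → ∑[ w ∈ xs ] ⟦ a ≡ w ⟧ * h w ≡ h a
∑-select {a} {xs} h uxs a∈xs =
  trans (∑-⟦≡⟧-* xs a h) (trans (cong (_* h a) (count≡1 uxs a∈xs)) (*-identityˡ (h a)))

IsMSet : ℕ → List ℕ → Set
IsMSet m C = Unique C × length C ≡ m

others+count : ∀ {q A} b → IsMSet (suc (suc q)) A →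
               (∑[ w ∈ A ] ⟦ w ≠ b ⟧) + count b A ≡ suc (suc q)
others+count {A = A} b (_ , |A|) = trans (∑-ι-not A (_≡ᵇ b)) |A|

others≥ : ∀ {q A} b → IsMSet (suc (suc q)) A → suc q ≤ ∑[ w ∈ A ] ⟦ w ≠ b ⟧
others≥ {q} {A} b mA@(uA , _) = +-cancelʳ-≤ 1 (suc q) N (begin
  suc q + 1     ≡⟨ +-comm (suc q) 1 ⟩
  suc (suc q)   ≡⟨ others+count b mA ⟨
  N + count b A ≤⟨ +-monoʳ-≤ N (count≤1 b uA) ⟩
  N + 1         ∎)
  where
  open ≤-Reasoning
  N : ℕ
  N = ∑[ w ∈ A ] ⟦ w ≠ b ⟧

others≥′ : ∀ {q A} b → IsMSet (suc (suc q)) A → suc q ≤ ∑[ w ∈ A ] ⟦ b ≠ w ⟧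
others≥′ {A = A} b mA = ≤-trans (others≥ b mA) (≤-reflexive (sym (∑-≡ᵇ-comm A b (ι ∘ not))))

others≡ : ∀ {q A b} → IsMSet (suc (suc q)) A → b ∈ A → ∑[ w ∈ A ] ⟦ b ≠ w ⟧ ≡ suc q
others≡ {q} {A} {b} mA@(uA , _) b∈A = +-cancelʳ-≡ 1 N (suc q) (begin
  N + 1         ≡⟨ cong (N +_) (count≡1 uA b∈A) ⟨
  N + count b A ≡⟨ cong (_+ count b A) (∑-≡ᵇ-comm A b (ι ∘ not)) ⟩
  (∑[ w ∈ A ] ⟦ w ≠ b ⟧) + count b A ≡⟨ others+count b mA ⟩
  suc (suc q)   ≡⟨ +-comm 1 (suc q) ⟩
  suc q + 1     ∎)
  where
  open ≡-Reasoning
  N : ℕ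
  N = ∑[ w ∈ A ] ⟦ b ≠ w ⟧

avoidCount : List ℕ → ℕ → ℕ → ℕ
avoidCount C a b = ∑[ c ∈ C ] ⟦ a ≠ c ⟧ * ⟦ c ≠ b ⟧

avoidCount-identity : ∀ C a b →
  avoidCount C a b + (count a C + count b C) ≡ length C + count a C * ⟦ a ≡ b ⟧
avoidCount-identity C a b = begin
  avoidCount C a b + (count a C + count b C)
    ≡⟨ cong (λ n → avoidCount C a b + (n + count b C)) (∑-≡ᵇ-comm C a ι) ⟨
  avoidCount C a b + ((∑[ c ∈ C ] ⟦ a ≡ c ⟧) + count b C)
    ≡⟨ cong (avoidCount C a b +_) (∑-distrib-+ C _ _) ⟨
  avoidCount C a b + (∑[ c ∈ C ] (⟦ a ≡ c ⟧ + ⟦ c ≡ b ⟧))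
    ≡⟨ ∑-distrib-+ C _ _ ⟨
  ∑[ c ∈ C ] (⟦ a ≠ c ⟧ * ⟦ c ≠ b ⟧ + (⟦ a ≡ c ⟧ + ⟦ c ≡ b ⟧))
    ≡⟨ ∑-cong C (λ c → ι-inclusion-exclusion (a ≡ᵇ c) (c ≡ᵇ b)) ⟩
  ∑[ c ∈ C ] (1 + ⟦ a ≡ c ⟧ * ⟦ c ≡ b ⟧)
    ≡⟨ ∑-distrib-+ C _ _ ⟩
  (∑[ _ ∈ C ] 1) + (∑[ c ∈ C ] ⟦ a ≡ c ⟧ * ⟦ c ≡ b ⟧)
    ≡⟨ cong₂ _+_ (∑-length C) (∑-⟦≡⟧-* C a (λ c → ⟦ c ≡ b ⟧)) ⟩
  length C + count a C * ⟦ a ≡ b ⟧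
    ∎
  where open ≡-Reasoning

avoidCount≥ : ∀ {q C} a b → IsMSet (suc (suc q)) C → q ≤ avoidCount C a b
avoidCount≥ {q} {C} a b (uC , |C|) = +-cancelʳ-≤ 2 q (avoidCount C a b) (begin
  q + 2                                      ≡⟨ +-comm q 2 ⟩
  suc (suc q)                                ≡⟨ |C| ⟨
  length C                                   ≤⟨ m≤m+n (length C) _ ⟩
  length C + count a C * ⟦ a ≡ b ⟧           ≡⟨ avoidCount-identity C a b ⟨
  avoidCount C a b + (count a C + count b C) ≤⟨ +-monoʳ-≤ _ (+-mono-≤ (count≤1 a uC) (count≤1 b uC)) ⟩
  avoidCount C a b + 2                       ∎)
  where open ≤-Reasoning

avoidCount-uniform : ∀ {q U a b} → IsMSet (suc (suc q)) U → a ∈ U → b ∈ U →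
                     avoidCount U a b ≡ q + ⟦ a ≡ b ⟧
avoidCount-uniform {q} {U} {a} {b} (uU , |U|) a∈U b∈U = +-cancelʳ-≡ 2 _ _ (begin
  avoidCount U a b + 2
    ≡⟨ cong₂ (λ x y → avoidCount U a b + (x + y)) (count≡1 uU a∈U) (count≡1 uU b∈U) ⟨
  avoidCount U a b + (count a U + count b U)
    ≡⟨ avoidCount-identity U a b ⟩
  length U + count a U * ⟦ a ≡ b ⟧
    ≡⟨ cong₂ (λ l n → l + n * ⟦ a ≡ b ⟧) |U| (count≡1 uU a∈U) ⟩
  suc (suc q) + 1 * ⟦ a ≡ b ⟧
    ≡⟨ shift q ⟦ a ≡ b ⟧ ⟩
  q + ⟦ a ≡ b ⟧ + 2
    ∎)
  where
  open ≡-Reasoning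
  shift : ∀ q i → suc (suc q) + 1 * i ≡ q + i + 2
  shift = solve-∀

-- Counting the colourings of Θ(2, 2, r + 1)

countTrue-++ : ∀ {A : Set} (p : A → Bool) xs ys → countTrue p (xs ++ ys) ≡ countTrue p xs + countTrue p ys
countTrue-++ p []       ys = refl
countTrue-++ p (x ∷ xs) ys with p x
... | true  = cong suc (countTrue-++ p xs ys)
... | false = countTrue-++ p xs ys

countTrue-map : ∀ {A B : Set} (p : B → Bool) (f : A → B) xs →
                countTrue p (map f xs) ≡ countTrue (p ∘ f) xs
countTrue-map p f []       = refl
countTrue-map p f (x ∷ xs) with p (f x)
... | true  = cong suc (countTrue-map p f xs)
... | false = countTrue-map p f xs

countTrue-cong : ∀ {A : Set} {p p′ : A → Bool} xs → (∀ x → p x ≡ p′ x) →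
                 countTrue p xs ≡ countTrue p′ xs
countTrue-cong                []       eq = refl
countTrue-cong {p′ = p′} (x ∷ xs) eq rewrite eq x with p′ x
... | true  = cong suc (countTrue-cong xs eq)
... | false = countTrue-cong xs eq

countTrue-if : ∀ {A : Set} β (p : A → Bool) xs →
               countTrue (λ x → if β then p x else false) xs ≡ ι β * countTrue p xs
countTrue-if true  p xs       = sym (+-identityʳ _)
countTrue-if false p []       = refl
countTrue-if false p (x ∷ xs) = countTrue-if false p xs

countTrue-choicesFrom : ∀ L (p : List ℕ → Bool) i n →
  countTrue p (choicesFrom L i (suc n))
    ≡ ∑[ c ∈ L i ] countTrue (λ ws → p (c ∷ ws)) (choicesFrom L (suc i) n)
countTrue-choicesFrom L p i n = go (L i)
  where
  tails : List (List ℕ)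
  tails = choicesFrom L (suc i) n
  go : ∀ cs → countTrue p (concatMap (λ c → map (c ∷_) tails) cs)
            ≡ ∑[ c ∈ cs ] countTrue (λ ws → p (c ∷ ws)) tails
  go []       = refl
  go (c ∷ cs) = trans (countTrue-++ p (map (c ∷_) tails) (concatMap (λ c → map (c ∷_) tails) cs))
                      (cong₂ _+_ (countTrue-map p (c ∷_) tails) (go cs))

segment : ListAssignment → ℕ → ℕ → List (List ℕ)
segment L s zero    = []
segment L s (suc r) = L s ∷ segment L (suc s) r

pathCount : List (List ℕ) → ℕ → ℕ → ℕ
pathCount []       a b = ⟦ a ≠ b ⟧
pathCount (C ∷ Cs) a b = ∑[ w ∈ C ] ⟦ a ≠ w ⟧ * pathCount Cs w b

edgeProper : List ℕ → ℕ × ℕ → Bool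
edgeProper f e = not (nth f (proj₁ e) ≡ᵇ nth f (proj₂ e))

nth-++ˡ : ∀ pre ws {i} → i < length pre → nth (pre ++ ws) i ≡ nth pre i
nth-++ˡ (x ∷ pre) ws {zero}  _         = refl
nth-++ˡ (x ∷ pre) ws {suc i} (s≤s i<n) = nth-++ˡ pre ws i<n

nth-length : ∀ pre w ws → nth (pre ++ w ∷ ws) (length pre) ≡ w
nth-length []        w ws = refl
nth-length (x ∷ pre) w ws = nth-length pre w ws

ι-if : ∀ β → (if (if β then true else false) then 1 else 0) ≡ ι β
ι-if true  = refl
ι-if false = refl

countTrue-path : ∀ L r pre {s p t} → length pre ≡ s → p < s → t < s →
  countTrue (λ ws → allB (edgeProper (pre ++ ws)) (pathEdges p t s (suc r))) (choicesFrom L s r)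
    ≡ pathCount (segment L s r) (nth pre p) (nth pre t)
countTrue-path L zero    pre refl p<s t<s rewrite ++-identityʳ pre = ι-if _
countTrue-path L (suc r) pre {s} {p} {t} refl p<s t<s = begin
  countTrue (λ ws → allB (edgeProper (pre ++ ws)) (pathEdges p t s (suc (suc r)))) (choicesFrom L s (suc r))
    ≡⟨ countTrue-choicesFrom L _ s r ⟩
  ∑[ w ∈ L s ] countTrue (λ ws → allB (edgeProper (pre ++ w ∷ ws)) (pathEdges p t s (suc (suc r)))) rest
    ≡⟨ ∑-cong (L s) (λ w → countTrue-cong rest (first-edge w)) ⟩
  ∑[ w ∈ L s ] countTrue (λ ws → if not (nth pre p ≡ᵇ w) then extended w ws else false) rest
    ≡⟨ ∑-cong (L s) (λ w → countTrue-if (not (nth pre p ≡ᵇ w)) (extended w) rest) ⟩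
  ∑[ w ∈ L s ] ⟦ nth pre p ≠ w ⟧ * countTrue (extended w) rest
    ≡⟨ ∑-cong (L s) (λ w → cong (⟦ nth pre p ≠ w ⟧ *_) (trans (IH w) (ends w))) ⟩
  ∑[ w ∈ L s ] ⟦ nth pre p ≠ w ⟧ * pathCount (segment L (suc s) r) w (nth pre t)
    ∎
  where
  open ≡-Reasoning
  rest : List (List ℕ)
  rest = choicesFrom L (suc s) r
  extended : ℕ → List ℕ → Bool
  extended w ws = allB (edgeProper ((pre ++ w ∷ []) ++ ws)) (pathEdges s t (suc s) (suc r))
  first-edge : ∀ w ws → allB (edgeProper (pre ++ w ∷ ws)) (pathEdges p t s (suc (suc r)))
                      ≡ (if not (nth pre p ≡ᵇ w) then extended w ws else false)
  first-edge w ws rewrite nth-++ˡ pre (w ∷ ws) p<s | nth-length pre w ws | ++-assoc pre (w ∷ []) ws = refl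
  IH : ∀ w → countTrue (extended w) rest
           ≡ pathCount (segment L (suc s) r) (nth (pre ++ w ∷ []) s) (nth (pre ++ w ∷ []) t)
  IH w = countTrue-path L r (pre ++ w ∷ []) (trans (length-++ pre) (+-comm (length pre) 1))
                        ≤-refl (m<n⇒m<1+n t<s)
  ends : ∀ w → pathCount (segment L (suc s) r) (nth (pre ++ w ∷ []) s) (nth (pre ++ w ∷ []) t)
             ≡ pathCount (segment L (suc s) r) w (nth pre t)
  ends w = cong₂ (pathCount (segment L (suc s) r)) (nth-length pre w []) (nth-++ˡ pre (w ∷ []) t<s)

PL-Θ₂₂ : ∀ L r → PL (Theta 2 2 (suc r)) L ≡
  ∑[ a ∈ L 0 ] ∑[ b ∈ L 1 ] avoidCount (L 2) a b * avoidCount (L 3) a b * pathCount (segment L 4 r) a b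
PL-Θ₂₂ L r = begin
  PL G L
    ≡⟨ colour-ends-and-middles ⟩
  ∑[ a ∈ L 0 ] ∑[ b ∈ L 1 ] ∑[ c ∈ L 2 ] ∑[ d ∈ L 3 ] proper a b c d
    ≡⟨ ∑-cong (L 0) (λ a → ∑-cong (L 1) (λ b → ∑-cong (L 2) (λ c →
         ∑-cong (L 3) (strip-edges a b c)))) ⟩
  ∑[ a ∈ L 0 ] ∑[ b ∈ L 1 ] ∑[ c ∈ L 2 ] ∑[ d ∈ L 3 ] edgeFactors a b c d
    ≡⟨ ∑-cong (L 0) (λ a → ∑-cong (L 1) (factor a)) ⟩
  ∑[ a ∈ L 0 ] ∑[ b ∈ L 1 ] avoidCount (L 2) a b * avoidCount (L 3) a b * N a b
    ∎
  where
  open ≡-Reasoning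
  G : Graph
  G = Theta 2 2 (suc r)
  rest : List (List ℕ)
  rest = choicesFrom L 4 r
  N : ℕ → ℕ → ℕ
  N = pathCount (segment L 4 r)
  proper : ℕ → ℕ → ℕ → ℕ → ℕ
  proper a b c d = countTrue (λ ws → isProper G (a ∷ b ∷ c ∷ d ∷ ws)) rest
  edgeFactors : ℕ → ℕ → ℕ → ℕ → ℕ
  edgeFactors a b c d = ⟦ a ≠ c ⟧ * (⟦ c ≠ b ⟧ * (⟦ a ≠ d ⟧ * (⟦ d ≠ b ⟧ * N a b)))
  colour-ends-and-middles :
    PL G L ≡ ∑[ a ∈ L 0 ] ∑[ b ∈ L 1 ] ∑[ c ∈ L 2 ] ∑[ d ∈ L 3 ] proper a b c d
  colour-ends-and-middles =
    trans (countTrue-choicesFrom L _ 0 (3 + r)) (∑-cong (L 0) λ a →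
    trans (countTrue-choicesFrom L _ 1 (2 + r)) (∑-cong (L 1) λ b →
    trans (countTrue-choicesFrom L _ 2 (1 + r)) (∑-cong (L 2) λ c →
    countTrue-choicesFrom L _ 3 r)))
  -- The edge list of G starts with 0–2, 2–1, 0–3, 3–1, and allB unfolds each into an `if`.
  strip-edges : ∀ a b c d → proper a b c d ≡ edgeFactors a b c d
  strip-edges a b c d =
    trans (countTrue-if (not (a ≡ᵇ c)) _ rest) (cong (⟦ a ≠ c ⟧ *_)
    (trans (countTrue-if (not (c ≡ᵇ b)) _ rest) (cong (⟦ c ≠ b ⟧ *_)
    (trans (countTrue-if (not (a ≡ᵇ d)) _ rest) (cong (⟦ a ≠ d ⟧ *_)
    (trans (countTrue-if (not (d ≡ᵇ b)) _ rest) (cong (⟦ d ≠ b ⟧ *_)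
    (countTrue-path L r (a ∷ b ∷ c ∷ d ∷ []) refl (s≤s z≤n) (s≤s (s≤s z≤n))))))))))
  factor : ∀ a b → ∑[ c ∈ L 2 ] ∑[ d ∈ L 3 ] edgeFactors a b c d
                 ≡ avoidCount (L 2) a b * avoidCount (L 3) a b * N a b
  factor a b = begin
    ∑[ c ∈ L 2 ] ∑[ d ∈ L 3 ] edgeFactors a b c d
      ≡⟨ ∑-cong (L 2) (λ c → ∑-cong (L 3) (λ d →
           regroup ⟦ a ≠ c ⟧ ⟦ c ≠ b ⟧ ⟦ a ≠ d ⟧ ⟦ d ≠ b ⟧ (N a b))) ⟩
    ∑[ c ∈ L 2 ] ∑[ d ∈ L 3 ] ⟦ a ≠ c ⟧ * ⟦ c ≠ b ⟧ * (⟦ a ≠ d ⟧ * ⟦ d ≠ b ⟧ * N a b)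
      ≡⟨ ∑-cong (L 2) (λ c → ∑-*ˡ (L 3) (⟦ a ≠ c ⟧ * ⟦ c ≠ b ⟧) _) ⟩
    ∑[ c ∈ L 2 ] ⟦ a ≠ c ⟧ * ⟦ c ≠ b ⟧ * (∑[ d ∈ L 3 ] ⟦ a ≠ d ⟧ * ⟦ d ≠ b ⟧ * N a b)
      ≡⟨ ∑-*ʳ (L 2) _ _ ⟩
    avoidCount (L 2) a b * (∑[ d ∈ L 3 ] ⟦ a ≠ d ⟧ * ⟦ d ≠ b ⟧ * N a b)
      ≡⟨ cong (avoidCount (L 2) a b *_) (∑-*ʳ (L 3) (N a b) _) ⟩
    avoidCount (L 2) a b * (avoidCount (L 3) a b * N a b)
      ≡⟨ *-assoc (avoidCount (L 2) a b) _ (N a b) ⟨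
    avoidCount (L 2) a b * avoidCount (L 3) a b * N a b
      ∎
    where
    regroup : ∀ i₁ i₂ i₃ i₄ n → i₁ * (i₂ * (i₃ * (i₄ * n))) ≡ i₁ * i₂ * (i₃ * i₄ * n)
    regroup = solve-∀

segment-const : ∀ C s r → segment (λ _ → C) s r ≡ replicate r C
segment-const C s zero    = refl
segment-const C s (suc r) = cong (C ∷_) (segment-const C (suc s) r)

length-segment : ∀ L s r → length (segment L s r) ≡ r
length-segment L s zero    = refl
length-segment L s (suc r) = cong suc (length-segment L (suc s) r)

segment-All : ∀ {P : List ℕ → Set} L s r → (∀ j → j < s + r → P (L j)) → All P (segment L s r)
segment-All L s zero    _ = []
segment-All L s (suc r) H = H s (m<m+n s z<s)
                          ∷ segment-All L (suc s) r (λ j j< → H j (subst (j <_) (sym (+-suc s r)) j<))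

-- Lower bounds for paths

pathCount-∷∷ : ∀ C₁ C₂ Cs a b →
               pathCount (C₁ ∷ C₂ ∷ Cs) a b ≡ ∑[ w ∈ C₂ ] avoidCount C₁ a w * pathCount Cs w b
pathCount-∷∷ C₁ C₂ Cs a b = begin
  ∑[ v ∈ C₁ ] ⟦ a ≠ v ⟧ * (∑[ w ∈ C₂ ] ⟦ v ≠ w ⟧ * g w)
    ≡⟨ ∑-cong C₁ (λ v → ∑-*ˡ C₂ ⟦ a ≠ v ⟧ _) ⟨
  ∑[ v ∈ C₁ ] ∑[ w ∈ C₂ ] ⟦ a ≠ v ⟧ * (⟦ v ≠ w ⟧ * g w)
    ≡⟨ ∑-cong C₁ (λ v → ∑-cong C₂ (λ w → *-assoc ⟦ a ≠ v ⟧ ⟦ v ≠ w ⟧ (g w))) ⟨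
  ∑[ v ∈ C₁ ] ∑[ w ∈ C₂ ] ⟦ a ≠ v ⟧ * ⟦ v ≠ w ⟧ * g w
    ≡⟨ ∑-comm-*ʳ C₁ C₂ (λ v w → ⟦ a ≠ v ⟧ * ⟦ v ≠ w ⟧) g ⟩
  ∑[ w ∈ C₂ ] avoidCount C₁ a w * g w
    ∎
  where
  open ≡-Reasoning
  g : ℕ → ℕ
  g w = pathCount Cs w b

∑-pathCount≥ : ∀ {q A} Cs b → IsMSet (suc (suc q)) A → All (IsMSet (suc (suc q))) Cs →
               suc q ^ suc (length Cs) ≤ ∑[ w ∈ A ] pathCount Cs w b
∑-pathCount≥ {q} {A} [] b mA [] =
  subst (_≤ ∑[ w ∈ A ] ⟦ w ≠ b ⟧) (sym (*-identityʳ (suc q))) (others≥ b mA)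
∑-pathCount≥ {q} {A} (C ∷ Cs) b mA (mC ∷ mCs) = begin
  suc q * suc q ^ suc (length Cs)
    ≤⟨ *-monoʳ-≤ (suc q) (∑-pathCount≥ Cs b mC mCs) ⟩
  suc q * (∑[ v ∈ C ] g v)
    ≡⟨ ∑-*ˡ C (suc q) g ⟨
  ∑[ v ∈ C ] suc q * g v
    ≤⟨ ∑-mono-≤ C (λ v → *-monoˡ-≤ (g v) (others≥ v mA)) ⟩
  ∑[ v ∈ C ] (∑[ w ∈ A ] ⟦ w ≠ v ⟧) * g v
    ≡⟨ ∑-comm-*ʳ A C (λ w v → ⟦ w ≠ v ⟧) g ⟨
  ∑[ w ∈ A ] pathCount (C ∷ Cs) w b
    ∎
  where
  open ≤-Reasoning
  g : ℕ → ℕ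
  g v = pathCount Cs v b

∑-avoidCount≥ : ∀ {q C₁ C₂} a → IsMSet (suc (suc q)) C₁ → IsMSet (suc (suc q)) C₂ →
                suc q * suc q ≤ ∑[ w ∈ C₂ ] avoidCount C₁ a w
∑-avoidCount≥ {q} {C₁} {C₂} a m₁ m₂ = begin
  suc q * suc q
    ≤⟨ *-monoˡ-≤ (suc q) (others≥′ a m₁) ⟩
  (∑[ v ∈ C₁ ] ⟦ a ≠ v ⟧) * suc q
    ≡⟨ ∑-*ʳ C₁ (suc q) _ ⟨
  ∑[ v ∈ C₁ ] ⟦ a ≠ v ⟧ * suc q
    ≤⟨ ∑-mono-≤ C₁ (λ v → *-monoʳ-≤ ⟦ a ≠ v ⟧ (others≥′ v m₂)) ⟩
  ∑[ v ∈ C₁ ] ⟦ a ≠ v ⟧ * (∑[ w ∈ C₂ ] ⟦ v ≠ w ⟧)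
    ≡⟨ ∑-cong C₁ (λ v → ∑-*ˡ C₂ ⟦ a ≠ v ⟧ _) ⟨
  ∑[ v ∈ C₁ ] ∑[ w ∈ C₂ ] ⟦ a ≠ v ⟧ * ⟦ v ≠ w ⟧
    ≡⟨ ∑-comm C₁ C₂ _ ⟩
  ∑[ w ∈ C₂ ] avoidCount C₁ a w
    ∎
  where open ≤-Reasoning

-- For odd r, pathFloor q r is the number of colourings from q + 2 colours of the r inner vertices
-- of a path whose ends carry two given distinct colours; for even r it is only a lower bound.
pathFloor : ℕ → ℕ → ℕ
pathFloor q zero          = 0
pathFloor q (suc zero)    = q
pathFloor q (suc (suc r)) = suc q * suc q * pathFloor q r + q

pathFloor≥ : ∀ q r → q ≤ pathFloor q (suc r)
pathFloor≥ q zero    = ≤-refl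
pathFloor≥ q (suc r) = m≤n+m q _

pathFloor-power : ∀ q r → suc (suc q) * pathFloor q r + 1 ≤ suc q ^ suc r
pathFloor-power q zero          = subst (_≤ suc q * 1) (sym (cong (_+ 1) (*-zeroʳ (suc (suc q))))) (s≤s z≤n)
pathFloor-power q (suc zero)    = ≤-reflexive (square q)
  where
  square : ∀ q → suc (suc q) * q + 1 ≡ suc q * (suc q * 1)
  square = solve-∀
pathFloor-power q (suc (suc r)) = begin
  suc (suc q) * pathFloor q (suc (suc r)) + 1
    ≡⟨ step q (pathFloor q r) ⟩
  suc q * (suc q * (suc (suc q) * pathFloor q r + 1))
    ≤⟨ *-monoʳ-≤ (suc q) (*-monoʳ-≤ (suc q) (pathFloor-power q r)) ⟩
  suc q ^ suc (suc (suc r))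
    ∎
  where
  open ≤-Reasoning
  step : ∀ q F → suc (suc q) * (suc q * suc q * F + q) + 1 ≡ suc q * (suc q * (suc (suc q) * F + 1))
  step = solve-∀

pathCount≥pathFloor : ∀ {q} Cs a b → All (IsMSet (suc (suc q))) Cs →
                      pathFloor q (length Cs) ≤ pathCount Cs a b
pathCount≥pathFloor     []             a b _              = z≤n
pathCount≥pathFloor     (C ∷ [])       a b (mC ∷ [])      = avoidCount≥ a b mC
pathCount≥pathFloor {q} (C₁ ∷ C₂ ∷ Cs) a b (m₁ ∷ m₂ ∷ ms) =
  +-cancelʳ-≤ (suc (suc q) * (q * F)) _ _ (begin
    suc q * suc q * F + q + suc (suc q) * (q * F)
      ≡⟨ regroup q F ⟩
    q * (suc (suc q) * F + 1) + suc q * suc q * F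
      ≤⟨ +-mono-≤ (*-monoʳ-≤ q S≥) (*-monoˡ-≤ F (∑-avoidCount≥ a m₁ m₂)) ⟩
    q * ∑ C₂ g + ∑ C₂ x * F
      ≤⟨ ∑-rearrangement C₂ x g (λ w → avoidCount≥ a w m₁) (λ w → pathCount≥pathFloor Cs w b ms) ⟩
    (∑[ w ∈ C₂ ] x w * g w) + length C₂ * (q * F)
      ≡⟨ cong₂ (λ n l → n + l * (q * F)) (pathCount-∷∷ C₁ C₂ Cs a b) (sym (proj₂ m₂)) ⟨
    pathCount (C₁ ∷ C₂ ∷ Cs) a b + suc (suc q) * (q * F)
      ∎)
  where
  open ≤-Reasoning
  F : ℕ
  F = pathFloor q (length Cs)
  x g : ℕ → ℕ
  x w = avoidCount C₁ a w
  g w = pathCount Cs w b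
  S≥ : suc (suc q) * F + 1 ≤ ∑ C₂ g
  S≥ = ≤-trans (pathFloor-power q (length Cs)) (∑-pathCount≥ Cs b m₂ ms)
  regroup : ∀ q F → suc q * suc q * F + q + suc (suc q) * (q * F)
                  ≡ q * (suc (suc q) * F + 1) + suc q * suc q * F
  regroup = solve-∀

PL-Θ₂₂≥ : ∀ {q} n L → IsMAssignment (Theta 2 2 (suc (suc (2 * n)))) (suc (suc q)) L →
  (∑[ a ∈ L 0 ] ∑[ b ∈ L 1 ] avoidCount (L 2) a b * avoidCount (L 3) a b) * pathFloor q (suc (2 * n))
    ≤ PL (Theta 2 2 (suc (suc (2 * n)))) L
PL-Θ₂₂≥ {q} n L isM = begin
  (∑[ a ∈ L 0 ] ∑[ b ∈ L 1 ] X a b) * F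
    ≡⟨ ∑-*ʳ (L 0) F _ ⟨
  ∑[ a ∈ L 0 ] (∑[ b ∈ L 1 ] X a b) * F
    ≡⟨ ∑-cong (L 0) (λ a → ∑-*ʳ (L 1) F (X a)) ⟨
  ∑[ a ∈ L 0 ] ∑[ b ∈ L 1 ] X a b * F
    ≤⟨ ∑-mono-≤ (L 0) (λ a → ∑-mono-≤ (L 1) (λ b → *-monoʳ-≤ (X a b) (floor a b))) ⟩
  ∑[ a ∈ L 0 ] ∑[ b ∈ L 1 ] X a b * pathCount seg a b
    ≡⟨ PL-Θ₂₂ L r ⟨
  PL (Theta 2 2 (suc r)) L
    ∎
  where
  open ≤-Reasoning
  r F : ℕ
  r = suc (2 * n)
  F = pathFloor q r
  seg : List (List ℕ)
  seg = segment L 4 r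
  X : ℕ → ℕ → ℕ
  X a b = avoidCount (L 2) a b * avoidCount (L 3) a b
  floor : ∀ a b → F ≤ pathCount seg a b
  floor a b = subst (λ l → pathFloor q l ≤ pathCount seg a b) (length-segment L 4 r)
                    (pathCount≥pathFloor seg a b (segment-All L 4 r isM))

-- The constant assignment

pathCount-uniform : ∀ {q U} n {a b} → IsMSet (suc (suc q)) U → a ∈ U → b ∈ U →
  pathCount (replicate (suc (2 * n)) U) a b ≡ pathFloor q (suc (2 * n)) + ⟦ a ≡ b ⟧
pathCount-uniform zero mU a∈U b∈U = avoidCount-uniform mU a∈U b∈U
pathCount-uniform {q} {U} (suc n) {a} {b} mU@(uU , |U|) a∈U b∈U = begin
  pathCount (replicate (suc (2 * suc n)) U) a b
    ≡⟨ cong (λ k → pathCount (replicate (suc k) U) a b) (*-suc 2 n) ⟩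
  pathCount (U ∷ U ∷ R) a b
    ≡⟨ pathCount-∷∷ U U R a b ⟩
  ∑[ w ∈ U ] avoidCount U a w * pathCount R w b
    ≡⟨ ∑-cong∈ U (λ w∈U →
         cong₂ _*_ (avoidCount-uniform mU a∈U w∈U) (pathCount-uniform n mU w∈U b∈U)) ⟩
  ∑[ w ∈ U ] (q + ⟦ a ≡ w ⟧) * h w
    ≡⟨ ∑-cong U (λ w → *-distribʳ-+ (h w) q _) ⟩
  ∑[ w ∈ U ] (q * h w + ⟦ a ≡ w ⟧ * h w)
    ≡⟨ ∑-distrib-+ U _ _ ⟩
  (∑[ w ∈ U ] q * h w) + (∑[ w ∈ U ] ⟦ a ≡ w ⟧ * h w)
    ≡⟨ cong₂ _+_ (∑-*ˡ U q h) (∑-select h uU a∈U) ⟩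
  q * ∑ U h + h a
    ≡⟨ cong (λ t → q * t + h a) ∑h ⟩
  q * (suc (suc q) * F + 1) + (F + ⟦ a ≡ b ⟧)
    ≡⟨ regroup q F ⟦ a ≡ b ⟧ ⟩
  suc q * suc q * F + q + ⟦ a ≡ b ⟧
    ≡⟨ cong (λ k → pathFloor q (suc k) + ⟦ a ≡ b ⟧) (*-suc 2 n) ⟨
  pathFloor q (suc (2 * suc n)) + ⟦ a ≡ b ⟧
    ∎
  where
  open ≡-Reasoning
  R : List (List ℕ)
  R = replicate (suc (2 * n)) U
  F : ℕ
  F = pathFloor q (suc (2 * n))
  h : ℕ → ℕ
  h w = F + ⟦ w ≡ b ⟧
  ∑h : ∑ U h ≡ suc (suc q) * F + 1
  ∑h = trans (∑-distrib-+ U (λ _ → F) (λ w → ⟦ w ≡ b ⟧))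
             (cong₂ _+_ (trans (∑-const U F) (cong (_* F) |U|)) (count≡1 uU b∈U))
  regroup : ∀ q F i → q * (suc (suc q) * F + 1) + (F + i) ≡ suc q * suc q * F + q + i
  regroup = solve-∀

∑∑-diagonal : ∀ {q U} (φ : Bool → ℕ) → IsMSet (suc (suc q)) U →
              ∑[ a ∈ U ] ∑[ b ∈ U ] φ (a ≡ᵇ b) ≡ suc (suc q) * (suc q * φ false + φ true)
∑∑-diagonal {q} {U} φ mU@(uU , |U|) = begin
  ∑[ a ∈ U ] ∑[ b ∈ U ] φ (a ≡ᵇ b)          ≡⟨ ∑-cong∈ U row ⟩
  ∑[ _ ∈ U ] (suc q * φ false + φ true)     ≡⟨ ∑-const U _ ⟩
  length U * (suc q * φ false + φ true)     ≡⟨ cong (_* _) |U| ⟩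
  suc (suc q) * (suc q * φ false + φ true)  ∎
  where
  open ≡-Reasoning
  row : ∀ {a} → a ∈ U → ∑[ b ∈ U ] φ (a ≡ᵇ b) ≡ suc q * φ false + φ true
  row {a} a∈U = begin
    ∑[ b ∈ U ] φ (a ≡ᵇ b)
      ≡⟨ ∑-cong U (λ b → ι-interpolation φ (a ≡ᵇ b)) ⟩
    ∑[ b ∈ U ] (⟦ a ≠ b ⟧ * φ false + ⟦ a ≡ b ⟧ * φ true)
      ≡⟨ ∑-distrib-+ U _ _ ⟩
    (∑[ b ∈ U ] ⟦ a ≠ b ⟧ * φ false) + (∑[ b ∈ U ] ⟦ a ≡ b ⟧ * φ true)
      ≡⟨ cong₂ _+_ (∑-*ʳ U (φ false) _) (∑-select (λ _ → φ true) uU a∈U) ⟩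
    (∑[ b ∈ U ] ⟦ a ≠ b ⟧) * φ false + φ true
      ≡⟨ cong (λ t → t * φ false + φ true) (others≡ mU a∈U) ⟩
    suc q * φ false + φ true
      ∎

PL-Θ₂₂-uniform : ∀ {q U} n → IsMSet (suc (suc q)) U → let F = pathFloor q (suc (2 * n)) in
  PL (Theta 2 2 (suc (suc (2 * n)))) (λ _ → U) ≡ suc (suc q) * (suc q * (q * q * F) + suc q * suc q * suc F)
PL-Θ₂₂-uniform {q} {U} n mU = begin
  PL (Theta 2 2 (suc r)) (λ _ → U)
    ≡⟨ PL-Θ₂₂ (λ _ → U) r ⟩
  ∑[ a ∈ U ] ∑[ b ∈ U ] avoidCount U a b * avoidCount U a b * pathCount (segment (λ _ → U) 4 r) a b
    ≡⟨ ∑-cong∈ U (λ a∈U → ∑-cong∈ U (λ b∈U → entry a∈U b∈U)) ⟩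
  ∑[ a ∈ U ] ∑[ b ∈ U ] φ (a ≡ᵇ b)
    ≡⟨ ∑∑-diagonal φ mU ⟩
  suc (suc q) * (suc q * φ false + φ true)
    ≡⟨ cong (suc (suc q) *_) (simplify q F) ⟩
  suc (suc q) * (suc q * (q * q * F) + suc q * suc q * suc F)
    ∎
  where
  open ≡-Reasoning
  r F : ℕ
  r = suc (2 * n)
  F = pathFloor q r
  φ : Bool → ℕ
  φ β = (q + ι β) * (q + ι β) * (F + ι β)
  entry : ∀ {a b} → a ∈ U → b ∈ U →
          avoidCount U a b * avoidCount U a b * pathCount (segment (λ _ → U) 4 r) a b ≡ φ (a ≡ᵇ b)
  entry {a} {b} a∈U b∈U = cong₂ (λ x y → x * x * y) (avoidCount-uniform mU a∈U b∈U)
    (trans (cong (λ Cs → pathCount Cs a b) (segment-const U 4 r)) (pathCount-uniform n mU a∈U b∈U))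
  simplify : ∀ q F → suc q * ((q + 0) * (q + 0) * (F + 0)) + (q + 1) * (q + 1) * (F + 1)
                   ≡ suc q * (q * q * F) + suc q * suc q * suc F
  simplify = solve-∀

-- End lists that differ

commonCount : List ℕ → List ℕ → ℕ
commonCount A B = ∑[ a ∈ A ] count a B

commonCount-comm : ∀ A B → commonCount A B ≡ commonCount B A
commonCount-comm A B =
  trans (∑-comm A B (λ a b → ⟦ b ≡ a ⟧)) (∑-cong B (λ b → ∑-≡ᵇ-comm A b ι))

commonCount-full⇒⊆ : ∀ A {B} → Unique B → commonCount A B ≡ length A →
                     ∀ {c} → c ∈ A → c ∈ B
commonCount-full⇒⊆ A {B} uB full {c} c∈A with c ∈? B
... | yes c∈B = c∈B
... | no  c∉B = contradiction full (<⇒≢ common<)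
  where
  common< : commonCount A B < length A
  common< = ∑<length A (λ a → count a B) (λ a → count≤1 a uB) c∈A (∉⇒count≡0 c∉B)

commonCount< : ∀ {m A B} → IsMSet m A → IsMSet m B → ¬ SameSet A B → commonCount A B < m
commonCount< {m} {A} {B} (uA , |A|) (uB , |B|) A≉B = ≤∧≢⇒< common≤m λ common≡m →
  A≉B λ c → commonCount-full⇒⊆ A uB (trans common≡m (sym |A|))
          , commonCount-full⇒⊆ B uA (trans (commonCount-comm B A) (trans common≡m (sym |B|)))
  where
  common≤m : commonCount A B ≤ m
  common≤m = subst (commonCount A B ≤_) |A| (∑≤length A (λ a → count a B) (λ a → count≤1 a uB))

∑-count-product≤ : ∀ A B {C} → Unique C → ∑[ c ∈ C ] count c A * count c B ≤ commonCount A B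
∑-count-product≤ A B {C} uC = begin
  ∑[ c ∈ C ] count c A * count c B
    ≡⟨ ∑-cong C (λ c → ∑-*ʳ A (count c B) (λ a → ⟦ a ≡ c ⟧)) ⟨
  ∑[ c ∈ C ] ∑[ a ∈ A ] ⟦ a ≡ c ⟧ * count c B
    ≡⟨ ∑-comm C A _ ⟩
  ∑[ a ∈ A ] ∑[ c ∈ C ] ⟦ a ≡ c ⟧ * count c B
    ≡⟨ ∑-cong A (λ a → ∑-⟦≡⟧-* C a (λ c → count c B)) ⟩
  ∑[ a ∈ A ] count a C * count a B
    ≤⟨ ∑-mono-≤ A (λ a → *-monoˡ-≤ (count a B) (count≤1 a uC)) ⟩
  ∑[ a ∈ A ] 1 * count a B
    ≡⟨ ∑-cong A (λ a → *-identityˡ (count a B)) ⟩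
  commonCount A B
    ∎
  where open ≤-Reasoning

∑∑-avoidCount : ∀ A B C → ∑[ a ∈ A ] ∑[ b ∈ B ] avoidCount C a b
                        ≡ ∑[ c ∈ C ] (∑[ a ∈ A ] ⟦ a ≠ c ⟧) * (∑[ b ∈ B ] ⟦ c ≠ b ⟧)
∑∑-avoidCount A B C = begin
  ∑[ a ∈ A ] ∑[ b ∈ B ] ∑[ c ∈ C ] ⟦ a ≠ c ⟧ * ⟦ c ≠ b ⟧
    ≡⟨ ∑-cong A (λ a → ∑-comm B C _) ⟩
  ∑[ a ∈ A ] ∑[ c ∈ C ] ∑[ b ∈ B ] ⟦ a ≠ c ⟧ * ⟦ c ≠ b ⟧
    ≡⟨ ∑-comm A C _ ⟩
  ∑[ c ∈ C ] ∑[ a ∈ A ] ∑[ b ∈ B ] ⟦ a ≠ c ⟧ * ⟦ c ≠ b ⟧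
    ≡⟨ ∑-cong C (λ c → ∑-cong A (λ a → ∑-*ˡ B ⟦ a ≠ c ⟧ _)) ⟩
  ∑[ c ∈ C ] ∑[ a ∈ A ] ⟦ a ≠ c ⟧ * (∑[ b ∈ B ] ⟦ c ≠ b ⟧)
    ≡⟨ ∑-cong C (λ c → ∑-*ʳ A _ _) ⟩
  ∑[ c ∈ C ] (∑[ a ∈ A ] ⟦ a ≠ c ⟧) * (∑[ b ∈ B ] ⟦ c ≠ b ⟧)
    ∎
  where open ≡-Reasoning

complement-product≥ : ∀ q {x y e f} → e ≤ 1 → f ≤ 1 →
                      x + e ≡ suc (suc q) → y + f ≡ suc (suc q) →
                      suc q * suc (suc q) ≤ x * y + suc q * (e * f)
complement-product≥ q {x} {y} {e} {f} e≤1 f≤1 x+e y+f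
  rewrite trans (sym (m+n∸n≡m x e)) (cong (_∸ e) x+e)
        | trans (sym (m+n∸n≡m y f)) (cong (_∸ f) y+f) = corners e≤1 f≤1
  where
  corners : ∀ {e f} → e ≤ 1 → f ≤ 1 →
            suc q * suc (suc q) ≤ (suc (suc q) ∸ e) * (suc (suc q) ∸ f) + suc q * (e * f)
  corners z≤n       z≤n       = ≤-trans (m≤m+n _ (suc (suc q))) (≤-reflexive (c₀₀ q))
    where
    c₀₀ : ∀ q → suc q * suc (suc q) + suc (suc q) ≡ suc (suc q) * suc (suc q) + suc q * (0 * 0)
    c₀₀ = solve-∀
  corners z≤n       (s≤s z≤n) = ≤-reflexive (c₀₁ q)
    where
    c₀₁ : ∀ q → suc q * suc (suc q) ≡ suc (suc q) * suc q + suc q * (0 * 1)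
    c₀₁ = solve-∀
  corners (s≤s z≤n) z≤n       = ≤-reflexive (c₁₀ q)
    where
    c₁₀ : ∀ q → suc q * suc (suc q) ≡ suc q * suc (suc q) + suc q * (1 * 0)
    c₁₀ = solve-∀
  corners (s≤s z≤n) (s≤s z≤n) = ≤-reflexive (c₁₁ q)
    where
    c₁₁ : ∀ q → suc q * suc (suc q) ≡ suc q * suc q + suc q * (1 * 1)
    c₁₁ = solve-∀

∑∑-avoidCount≥ : ∀ {q A B C} → let m = suc (suc q) in
  IsMSet m A → IsMSet m B → IsMSet m C → commonCount A B ≤ suc q →
  suc q * (m * m) ≤ (∑[ a ∈ A ] ∑[ b ∈ B ] avoidCount C a b) + suc q * suc q
∑∑-avoidCount≥ {q} {A} {B} {C} mA@(uA , _) mB@(uB , |B|) (uC , |C|) common≤ = begin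
  suc q * (m * m)
    ≡⟨ cong (λ l → suc q * (l * m)) |C| ⟨
  suc q * (length C * m)
    ≡⟨ reorder (suc q) (length C) m ⟩
  length C * (suc q * m)
    ≡⟨ ∑-const C (suc q * m) ⟨
  ∑[ _ ∈ C ] suc q * m
    ≤⟨ ∑-mono-≤ C pointwise ⟩
  ∑[ c ∈ C ] (nA c * nB c + suc q * (count c A * count c B))
    ≡⟨ ∑-distrib-+ C _ _ ⟩
  (∑[ c ∈ C ] nA c * nB c) + (∑[ c ∈ C ] suc q * (count c A * count c B))
    ≡⟨ cong₂ _+_ (∑∑-avoidCount A B C) (sym (∑-*ˡ C (suc q) _)) ⟨
  (∑[ a ∈ A ] ∑[ b ∈ B ] avoidCount C a b) + suc q * (∑[ c ∈ C ] count c A * count c B)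
    ≤⟨ +-monoʳ-≤ _ (*-monoʳ-≤ (suc q) (≤-trans (∑-count-product≤ A B uC) common≤)) ⟩
  (∑[ a ∈ A ] ∑[ b ∈ B ] avoidCount C a b) + suc q * suc q
    ∎
  where
  open ≤-Reasoning
  m : ℕ
  m = suc (suc q)
  nA nB : ℕ → ℕ
  nA c = ∑[ a ∈ A ] ⟦ a ≠ c ⟧
  nB c = ∑[ b ∈ B ] ⟦ c ≠ b ⟧
  pointwise : ∀ c → suc q * m ≤ nA c * nB c + suc q * (count c A * count c B)
  pointwise c = complement-product≥ q (count≤1 c uA) (count≤1 c uB) (others+count c mA)
    (trans (cong (nB c +_) (sym (∑-≡ᵇ-comm B c ι))) (trans (∑-ι-not B (c ≡ᵇ_)) |B|))
  reorder : ∀ a b c → a * (b * c) ≡ b * (a * c)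
  reorder = solve-∀

∑∑-rearrangement : ∀ {q} A B (x y : ℕ → ℕ → ℕ) →
  (∀ a b → q ≤ x a b) → (∀ a b → q ≤ y a b) →
  q * (∑[ a ∈ A ] ∑[ b ∈ B ] y a b) + (∑[ a ∈ A ] ∑[ b ∈ B ] x a b) * q
    ≤ (∑[ a ∈ A ] ∑[ b ∈ B ] x a b * y a b) + length A * (length B * (q * q))
∑∑-rearrangement {q} A B x y q≤x q≤y = begin
  q * (∑[ a ∈ A ] ∑[ b ∈ B ] y a b) + (∑[ a ∈ A ] ∑[ b ∈ B ] x a b) * q
    ≡⟨ cong₂ _+_ (∑-*ˡ A q _) (∑-*ʳ A q _) ⟨
  (∑[ a ∈ A ] q * (∑[ b ∈ B ] y a b)) + (∑[ a ∈ A ] (∑[ b ∈ B ] x a b) * q)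
    ≡⟨ ∑-distrib-+ A _ _ ⟨
  ∑[ a ∈ A ] (q * (∑[ b ∈ B ] y a b) + (∑[ b ∈ B ] x a b) * q)
    ≤⟨ ∑-mono-≤ A (λ a → ∑-rearrangement B (x a) (y a) (q≤x a) (q≤y a)) ⟩
  ∑[ a ∈ A ] ((∑[ b ∈ B ] x a b * y a b) + length B * (q * q))
    ≡⟨ ∑-distrib-+ A _ _ ⟩
  (∑[ a ∈ A ] ∑[ b ∈ B ] x a b * y a b) + (∑[ _ ∈ A ] length B * (q * q))
    ≡⟨ cong (_ +_) (∑-const A _) ⟩
  (∑[ a ∈ A ] ∑[ b ∈ B ] x a b * y a b) + length A * (length B * (q * q))
    ∎
  where open ≤-Reasoning

pairs-arith : ∀ s Q S₁ S₂ → let q = suc (suc s) ; m = suc (suc q) ; R = suc q * suc q in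
  q * S₂ + S₁ * q ≤ Q + m * (m * (q * q)) →
  suc q * (m * m) ≤ S₁ + R → suc q * (m * m) ≤ S₂ + R →
  m * m * (q * q) + (q + q + 1) * m + 2 ≤ Q
pairs-arith s Q S₁ S₂ h₀ h₁ h₂ = +-cancelʳ-≤ E K Q (begin
  K + E                                   ≤⟨ m≤m+n (K + E) slack ⟩
  K + E + slack                           ≡⟨ identity s ⟩
  q * V + V * q                           ≤⟨ +-mono-≤ (*-monoʳ-≤ q h₂) (*-monoˡ-≤ q h₁) ⟩
  q * (S₂ + R) + (S₁ + R) * q             ≡⟨ distribute q S₁ S₂ R ⟩
  (q * S₂ + S₁ * q) + (q * R + R * q)     ≤⟨ +-monoˡ-≤ (q * R + R * q) h₀ ⟩
  Q + m * (m * (q * q)) + (q * R + R * q) ≡⟨ +-assoc Q _ _ ⟩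
  Q + E                                   ∎)
  where
  open ≤-Reasoning
  q m R V K E slack : ℕ
  q = suc (suc s)
  m = suc (suc q)
  R = suc q * suc q
  V = suc q * (m * m)
  K = m * m * (q * q) + (q + q + 1) * m + 2
  E = m * (m * (q * q)) + (q * R + R * q)
  -- (q V + V q) − (K + E) = 2q² + q − 4, with q = s + 2
  slack = 2 * s * s + 9 * s + 6
  identity : ∀ s → let q = suc (suc s) ; m = suc (suc q) ; R = suc q * suc q ; V = suc q * (m * m) in
    m * m * (q * q) + (q + q + 1) * m + 2 + (m * (m * (q * q)) + (q * R + R * q)) + (2 * s * s + 9 * s + 6)
      ≡ q * V + V * q
  identity = solve-∀
  distribute : ∀ q S₁ S₂ R → q * (S₂ + R) + (S₁ + R) * q ≡ (q * S₂ + S₁ * q) + (q * R + R * q)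
  distribute = solve-∀

∑∑-avoidCount-product≥ : ∀ s {A B C D} → let q = suc (suc s) ; m = suc (suc q) in
  IsMSet m A → IsMSet m B → IsMSet m C → IsMSet m D → ¬ SameSet A B →
  m * m * (q * q) + (q + q + 1) * m + 2 ≤ ∑[ a ∈ A ] ∑[ b ∈ B ] avoidCount C a b * avoidCount D a b
∑∑-avoidCount-product≥ s {A} {B} {C} {D} mA@(_ , |A|) mB@(_ , |B|) mC mD A≉B =
  pairs-arith s Q (S C) (S D) rearranged
              (∑∑-avoidCount≥ mA mB mC common≤) (∑∑-avoidCount≥ mA mB mD common≤)
  where
  q m Q : ℕ
  q = suc (suc s)
  m = suc (suc q)
  Q = ∑[ a ∈ A ] ∑[ b ∈ B ] avoidCount C a b * avoidCount D a b
  S : List ℕ → ℕ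
  S E = ∑[ a ∈ A ] ∑[ b ∈ B ] avoidCount E a b
  common≤ : commonCount A B ≤ suc q
  common≤ = ≤-pred (commonCount< mA mB A≉B)
  rearranged : q * S D + S C * q ≤ Q + m * (m * (q * q))
  rearranged = subst₂ (λ k l → q * S D + S C * q ≤ Q + k * (l * (q * q))) |A| |B|
    (∑∑-rearrangement A B (avoidCount C) (avoidCount D)
                      (λ a b → avoidCount≥ a b mC) (λ a b → avoidCount≥ a b mD))

chromatic≤ : ∀ s F → let q = suc (suc s) ; m = suc (suc q) in suc q * suc q * q ≤ F →
  m * (suc q * (q * q * F) + suc q * suc q * suc F) ≤ (m * m * (q * q) + (q + q + 1) * m + 2) * F
chromatic≤ s F F≥ = begin
  m * (suc q * (q * q * F) + R * suc F)             ≡⟨ split q F ⟩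
  (m * m * (q * q) + (q + q + 1) * m) * F + m * R   ≤⟨ +-monoʳ-≤ _ m*R≤2F ⟩
  (m * m * (q * q) + (q + q + 1) * m) * F + (F + F) ≡⟨ merge q F ⟩
  (m * m * (q * q) + (q + q + 1) * m + 2) * F       ∎
  where
  open ≤-Reasoning
  q m R : ℕ
  q = suc (suc s)
  m = suc (suc q)
  R = suc q * suc q
  m*R≤2F : m * R ≤ F + F
  m*R≤2F = begin
    m * R          ≤⟨ *-monoˡ-≤ R (s≤s (s≤s (m≤n+m q s))) ⟩
    (q + q) * R    ≡⟨ *-distribʳ-+ R q q ⟩
    q * R + q * R  ≡⟨ cong₂ _+_ (*-comm q R) (*-comm q R) ⟩
    R * q + R * q  ≤⟨ +-mono-≤ F≥ F≥ ⟩
    F + F          ∎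
  split : ∀ q F → let m = suc (suc q) ; R = suc q * suc q in
    m * (suc q * (q * q * F) + R * suc F) ≡ (m * m * (q * q) + (q + q + 1) * m) * F + m * R
  split = solve-∀
  merge : ∀ q F → let m = suc (suc q) in
    (m * m * (q * q) + (q + q + 1) * m) * F + (F + F) ≡ (m * m * (q * q) + (q + q + 1) * m + 2) * F
  merge = solve-∀

Pm≤PL : ∀ s n L → let m = suc (suc (suc (suc s))) ; G = Theta 2 2 (suc (suc (2 * suc n))) in
  IsMAssignment G m L → ¬ SameSet (L 0) (L 1) → Pm G m ≤ PL G L
Pm≤PL s n L isM L₀≉L₁ = begin
  Pm G m
    ≡⟨ PL-Θ₂₂-uniform (suc n) (upTo⁺ m , length-upTo m) ⟩
  m * (suc q * (q * q * F) + suc q * suc q * suc F)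
    ≤⟨ chromatic≤ s F F≥ ⟩
  (m * m * (q * q) + (q + q + 1) * m + 2) * F
    ≤⟨ *-monoˡ-≤ F (∑∑-avoidCount-product≥ s (isM 0 z<s) (isM 1 (s≤s z<s))
                      (isM 2 (s≤s (s≤s z<s))) (isM 3 (s≤s (s≤s (s≤s z<s)))) L₀≉L₁) ⟩
  (∑[ a ∈ L 0 ] ∑[ b ∈ L 1 ] avoidCount (L 2) a b * avoidCount (L 3) a b) * F
    ≤⟨ PL-Θ₂₂≥ (suc n) L isM ⟩
  PL G L
    ∎
  where
  open ≤-Reasoning
  q m F : ℕ
  q = suc (suc s)
  m = suc (suc q)
  F = pathFloor q (suc (2 * suc n))
  G : Graph
  G = Theta 2 2 (suc (suc (2 * suc n)))
  F≥ : suc q * suc q * q ≤ F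
  F≥ = subst (λ k → suc q * suc q * q ≤ pathFloor q (suc k)) (sym (*-suc 2 n))
             (≤-trans (*-monoʳ-≤ (suc q * suc q) (pathFloor≥ q (2 * n))) (m≤m+n _ q))

mainTheorem15 : (k : ℕ) → 2 ≤ k → (m : ℕ) → 4 ≤ m → (L : ListAssignment) →
    IsMAssignment (Theta 2 2 (2 * k)) m L → ¬ SameSet (L 0) (L 1) →
    Pm (Theta 2 2 (2 * k)) m ≤ PL (Theta 2 2 (2 * k)) L
mainTheorem15 (suc (suc n)) (s≤s (s≤s z≤n)) m@(suc (suc (suc (suc s)))) (s≤s (s≤s (s≤s (s≤s z≤n))))
              L isM L₀≉L₁ =
  subst (λ l → IsMAssignment (Theta 2 2 l) m L → Pm (Theta 2 2 l) m ≤ PL (Theta 2 2 l) L)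
        (sym (*-suc 2 (suc n))) (λ isM′ → Pm≤PL s n L isM′ L₀≉L₁) isM
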